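{- Let $G$ be an undirected graph, let $X\subseteq T\subseteq V(G)$, and let $q,k$ be integers with $q\ge k$. Let $Y$ be a set with $X\subseteq Y\subseteq T$. If $X$ is $(q,k)$-unbreakable in $G$ and no vertex of $Y$ is $(X,T,q+k)$-carvable, then $Y$ is $(q+k,k)$-unbreakable in $G$.
   Context: A vertex cut of $G$ is an ordered pair $(L,R)$ with $L\cup R=V(G)$, $L\setminus R$ and $R\setminus L$ nonempty, and no edge between $L\setminus R$ and $R\setminus L$; its size is $|L\cap R|$. A set $Z$ is $(q,k)$-unbreakable in $G$ if every vertex cut $(L,R)$ of size at most $k$ satisfies $|L\cap Z|\le q$ or $|R\cap Z|\le q$. The torso $H_T$ of $T$ in $G$ is the graph with vertex set $T$ in which $u,v\in T$ are adjacent iff $\{u,v\}\in E(G)$ or $u,v\in N_G(D)$ for some connected component $D$ of $G\setminus T$ (where $N_G(D)$ is the set of vertices outside $D$ adjacent to $D$). For $X\subseteq T$ and an integer $k'$, an $(X,T,k')$-witness is a vertex cut $(L,R)$ of $G$ with $|L\cap R|\le k'$, $|L\cap T|>|L\cap R|$, and $X\subseteq R$; it is connected if $H_T[(L\setminus R)\cap T]$ is connected. A vertex $v$ is $(X,T,k')$-carvable if there is a connected $(X,T,k')$-witness $(L,R)$ with $v\in L\setminus R$. -}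

module Defs where

open import Data.Nat using (ℕ; _≤_; _<_)
open import Data.Fin using (Fin)
open import Data.Fin.Subset using (Subset; _∈_; _∉_; _⊆_; _∩_; _─_; ∣_∣)
open import Data.Product using (Σ; _×_; ∃)
open import Data.Sum using (_⊎_)
open import Relation.Nullary using (¬_)
open import Relation.Binary.PropositionalEquality using (_≡_)

record Graph : Set₁ where
  field
    n     : ℕ
    Adj   : Fin n → Fin n → Set
    sym   : ∀ {u v} → Adj u v → Adj v u
    irrefl : ∀ {u} → ¬ Adj u u

open Graph public

data Reach {m : ℕ} (E : Fin m → Fin m → Set) (S : Subset m) : Fin m → Fin m → Set where
  here : ∀ {u} → u ∈ S → Reach E S u u
  step : ∀ {u w v} → Reach E S u w → E w v → v ∈ S → Reach E S u v

ConnectedOn : {m : ℕ} → (Fin m → Fin m → Set) → Subset m → Set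
ConnectedOn E S = ∀ u v → u ∈ S → v ∈ S → Reach E S u v

module _ (G : Graph) where
  private
    V = Fin (n G)
    E = Adj G

  IsVertexCut : Subset (n G) → Subset (n G) → Set
  IsVertexCut L R =
      (∀ v → v ∈ L ⊎ v ∈ R)
    × (∃ λ v → v ∈ L ─ R)
    × (∃ λ v → v ∈ R ─ L)
    × (∀ u v → u ∈ L ─ R → v ∈ R ─ L → ¬ E u v)

  cutSize : Subset (n G) → Subset (n G) → ℕ
  cutSize L R = ∣ L ∩ R ∣

  Unbreakable : ℕ → ℕ → Subset (n G) → Set
  Unbreakable q k Z = ∀ L R → IsVertexCut L R → cutSize L R ≤ k →
    ∣ L ∩ Z ∣ ≤ q ⊎ ∣ R ∩ Z ∣ ≤ q

  -- D is a connected component of G \ T: a nonempty vertex set disjoint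
  -- from T, connected in G, and maximal (closed under G-adjacency within V \ T).
  IsComponent : Subset (n G) → Subset (n G) → Set
  IsComponent T D =
      (∀ v → v ∈ D → v ∉ T)
    × (∃ λ v → v ∈ D)
    × ConnectedOn E D
    × (∀ u v → u ∈ D → v ∉ T → E u v → v ∈ D)

  InNbhd : Subset (n G) → V → Set
  InNbhd D v = v ∉ D × ∃ λ u → u ∈ D × E u v

  -- Adjacency in the torso H_T of T in G (u ≠ v, as H_T is a simple graph).
  TorsoAdj : Subset (n G) → V → V → Set
  TorsoAdj T u v = u ∈ T × v ∈ T × ¬ u ≡ v ×
    (E u v ⊎ Σ (Subset (n G)) λ D → IsComponent T D × InNbhd D u × InNbhd D v)

  IsWitness : Subset (n G) → Subset (n G) → ℕ → Subset (n G) → Subset (n G) → Set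
  IsWitness X T k' L R =
      IsVertexCut L R
    × cutSize L R ≤ k'
    × cutSize L R < ∣ L ∩ T ∣
    × X ⊆ R

  IsConnectedWitness : Subset (n G) → Subset (n G) → ℕ → Subset (n G) → Subset (n G) → Set
  IsConnectedWitness X T k' L R =
    IsWitness X T k' L R × ConnectedOn (TorsoAdj T) ((L ─ R) ∩ T)

  Carvable : Subset (n G) → Subset (n G) → ℕ → V → Set
  Carvable X T k' v = Σ (Subset (n G)) λ L → Σ (Subset (n G)) λ R →
    IsConnectedWitness X T k' L R × v ∈ L ─ R

{-# OPTIONS --safe #-}
-- Suppose a cut (L, R) of size ≤ k has more than q + k vertices of Y on each side. As X is
-- (q,k)-unbreakable, one side, say L, has at most q vertices of X, and moving them to the right
-- gives a cut (L, R ∪ X) of size ≤ q + k with X on the right. Since Y ⊆ T, its left part holds more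
-- vertices of Y than its separator has vertices outside T; call such cuts heavy, and take one
-- with L ∖ R minimal. If the torso of T is connected on (L ∖ R) ∩ T, this heavy cut is a connected
-- witness carving a vertex of Y. Otherwise, cut L ∖ R along the vertices reachable from one
-- vertex c of it through L ∖ R and V ∖ T. This splits the separator vertices outside T into two
-- disjoint parts, so one of the two smaller cuts is again heavy.
module Submission where

open import Defs
open import Data.Nat using (ℕ; zero; suc; _≤_; _<_; _+_; z≤n; _≤?_; _<?_)
open import Data.Nat.Properties
  using (≤-trans; ≤-<-trans; +-suc; +-assoc; +-comm; +-mono-≤; +-monoˡ-≤; +-monoʳ-≤;
         +-monoˡ-<; +-monoʳ-<; +-cancelʳ-<; ≮⇒≥; ≰⇒>; <-irrefl; >⇒≢; module ≤-Reasoning)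
open import Data.Nat.Induction using (<-wellFounded)
open import Data.Fin using (Fin; zero; suc; _≟_)
open import Data.Fin.Subset
  using (Subset; inside; outside; _∈_; _∉_; _⊆_; _∩_; _∪_; _─_; ∁; ∣_∣; Nonempty)
open import Data.Fin.Subset.Properties
  using (_∈?_; x∈p∩q⁺; x∈p∩q⁻; x∈p∪q⁺; x∈p∪q⁻; x∈p∧x∉q⇒x∈p─q; p∩q⊆p; p∩q⊆q; p⊆p∪q; q⊆p∪q; p─q⊆p;
         x∈p⇒x∉∁p; x∈∁p⇒x∉p; x∉p⇒x∈∁p; x∉∁p⇒x∈p; p⊆q⇒∣p∣≤∣q∣; p⊂q⇒∣p∣<∣q∣;
         nonempty?; Empty-unique; ∣⊥∣≡0; ∩-comm)
open import Data.Vec using ([]; _∷_; here; there)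
open import Data.Product as Product using (∃; ∃₂; _×_; _,_; proj₁; proj₂; uncurry)
open import Data.Sum as Sum using (_⊎_; inj₁; inj₂; [_,_])
open import Data.Empty using (⊥-elim)
open import Function using (_∘_; id)
open import Induction.WellFounded using (module All)
open import Relation.Binary.Construct.On using (wellFounded)
open import Relation.Nullary using (¬_; yes; no; does; contradiction)
open import Relation.Nullary.Decidable using (¬¬-excluded-middle)
open import Relation.Unary using (Decidable)
open import Relation.Binary.PropositionalEquality using (_≡_; _≢_; refl; trans; cong; subst; subst₂)
  renaming (sym to ≡-sym)

private
  variable
    m : ℕ
    i x : Fin m
    p q r : Subset m

¬¬-∀-Fin : {P : Fin m → Set} → (∀ i → ¬ ¬ P i) → ¬ ¬ (∀ i → P i)
¬¬-∀-Fin {zero} _ k = k λ ()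
¬¬-∀-Fin {suc m} ¬¬P k =
  ¬¬P zero λ p₀ → ¬¬-∀-Fin (¬¬P ∘ suc) λ ps → k λ { zero → p₀ ; (suc i) → ps i }

¬¬-decidable : (P : Fin m → Set) → ¬ ¬ Decidable P
¬¬-decidable P = ¬¬-∀-Fin λ _ → ¬¬-excluded-middle

¬¬-decidable₂ : (P : Fin m → Fin m → Set) → ¬ ¬ (∀ i → Decidable (P i))
¬¬-decidable₂ P = ¬¬-∀-Fin λ i → ¬¬-decidable (P i)

toSubset : {P : Fin m → Set} → Decidable P → Subset m
toSubset {zero} P? = []
toSubset {suc m} P? = does (P? zero) ∷ toSubset (P? ∘ suc)

∈toSubset⁺ : {P : Fin m → Set} (P? : Decidable P) → P i → i ∈ toSubset P?
∈toSubset⁺ {i = zero} P? pi with P? zero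
... | yes _ = here
... | no ¬pi = contradiction pi ¬pi
∈toSubset⁺ {i = suc i} P? pi = there (∈toSubset⁺ (P? ∘ suc) pi)

∈toSubset⁻ : {P : Fin m → Set} (P? : Decidable P) → i ∈ toSubset P? → P i
∈toSubset⁻ {i = zero} P? i∈ with P? zero | i∈
... | yes pi | _ = pi
... | no _ | ()
∈toSubset⁻ {i = suc i} P? (there i∈) = ∈toSubset⁻ (P? ∘ suc) i∈

x∈p─q⁻ : (p q : Subset m) → x ∈ p ─ q → x ∈ p × x ∉ q
x∈p─q⁻ (inside ∷ p) (outside ∷ q) here = here , λ ()
x∈p─q⁻ {x = zero} (outside ∷ p) (outside ∷ q) ()
x∈p─q⁻ (_ ∷ p) (_ ∷ q) (there x∈) with x∈p─q⁻ p q x∈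
... | x∈p , x∉q = there x∈p , λ { (there x∈q) → x∉q x∈q }

x∈p∧x∉p─q⇒x∈q : (p q : Subset m) → x ∈ p → x ∉ p ─ q → x ∈ q
x∈p∧x∉p─q⇒x∈q {x = x} p q x∈p x∉p─q with x ∈? q
... | yes x∈q = x∈q
... | no x∉q = contradiction (x∈p∧x∉q⇒x∈p─q x∈p x∉q) x∉p─q

∣p∣≡∣p∩q∣+∣p∩∁q∣ : (p q : Subset m) → ∣ p ∣ ≡ ∣ p ∩ q ∣ + ∣ p ∩ ∁ q ∣
∣p∣≡∣p∩q∣+∣p∩∁q∣ [] [] = refl
∣p∣≡∣p∩q∣+∣p∩∁q∣ (outside ∷ p) (_ ∷ q) = ∣p∣≡∣p∩q∣+∣p∩∁q∣ p q
∣p∣≡∣p∩q∣+∣p∩∁q∣ (inside ∷ p) (inside ∷ q) = cong suc (∣p∣≡∣p∩q∣+∣p∩∁q∣ p q)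
∣p∣≡∣p∩q∣+∣p∩∁q∣ (inside ∷ p) (outside ∷ q) =
  trans (cong suc (∣p∣≡∣p∩q∣+∣p∩∁q∣ p q)) (≡-sym (+-suc ∣ p ∩ q ∣ ∣ p ∩ ∁ q ∣))

p⊆q∪r⇒∣p∣≤∣q∣+∣r∣ : p ⊆ q ∪ r → ∣ p ∣ ≤ ∣ q ∣ + ∣ r ∣
p⊆q∪r⇒∣p∣≤∣q∣+∣r∣ {p = p} {q} {r} p⊆q∪r = begin
  ∣ p ∣                     ≡⟨ ∣p∣≡∣p∩q∣+∣p∩∁q∣ p q ⟩
  ∣ p ∩ q ∣ + ∣ p ∩ ∁ q ∣   ≤⟨ +-mono-≤ (p⊆q⇒∣p∣≤∣q∣ (p∩q⊆q p q)) (p⊆q⇒∣p∣≤∣q∣ outside-q) ⟩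
  ∣ q ∣ + ∣ r ∣             ∎
  where
  open ≤-Reasoning
  outside-q : p ∩ ∁ q ⊆ r
  outside-q x∈ with x∈p∩q⁻ p (∁ q) x∈
  ... | x∈p , x∈∁q with x∈p∪q⁻ q r (p⊆q∪r x∈p)
  ...   | inj₁ x∈q = contradiction x∈q (x∈∁p⇒x∉p x∈∁q)
  ...   | inj₂ x∈r = x∈r

disjoint⇒∣p∣+∣q∣≤∣r∣ : p ⊆ r → q ⊆ r → (∀ {x} → x ∈ p → x ∉ q) → ∣ p ∣ + ∣ q ∣ ≤ ∣ r ∣
disjoint⇒∣p∣+∣q∣≤∣r∣ {p = p} {r} {q} p⊆r q⊆r disjoint = begin
  ∣ p ∣ + ∣ q ∣             ≤⟨ +-mono-≤ (p⊆q⇒∣p∣≤∣q∣ p⊆r∩p) (p⊆q⇒∣p∣≤∣q∣ q⊆r∩∁p) ⟩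
  ∣ r ∩ p ∣ + ∣ r ∩ ∁ p ∣   ≡⟨ ∣p∣≡∣p∩q∣+∣p∩∁q∣ r p ⟨
  ∣ r ∣                     ∎
  where
  open ≤-Reasoning
  p⊆r∩p : p ⊆ r ∩ p
  p⊆r∩p x∈p = x∈p∩q⁺ (p⊆r x∈p , x∈p)
  q⊆r∩∁p : q ⊆ r ∩ ∁ p
  q⊆r∩∁p x∈q = x∈p∩q⁺ (q⊆r x∈q , x∉p⇒x∈∁p (λ x∈p → disjoint x∈p x∈q))

m+n<o+p⇒m<o⊎n<p : ∀ {m n o p} → m + n < o + p → m < o ⊎ n < p
m+n<o+p⇒m<o⊎n<p {m} {n} {o} {p} m+n<o+p with m <? o | n <? p
... | yes m<o | _ = inj₁ m<o
... | no _ | yes n<p = inj₂ n<p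
... | no m≮o | no n≮p =
  contradiction (≤-<-trans (+-mono-≤ (≮⇒≥ m≮o) (≮⇒≥ n≮p)) m+n<o+p) (<-irrefl refl)

∣p∣>0⇒Nonempty : ∀ {m} {p : Subset m} → 0 < ∣ p ∣ → Nonempty p
∣p∣>0⇒Nonempty {m} {p} 0<∣p∣ with nonempty? p
... | yes ne = ne
... | no empty = contradiction (trans (cong ∣_∣ (Empty-unique empty)) (∣⊥∣≡0 m)) (>⇒≢ 0<∣p∣)

module _ {E : Fin m → Fin m → Set} {S : Subset m} where

  Reach-source : ∀ {u v} → Reach E S u v → u ∈ S
  Reach-source (here u∈S) = u∈S
  Reach-source (step walk _ _) = Reach-source walk

  Reach-target : ∀ {u v} → Reach E S u v → v ∈ S
  Reach-target (here v∈S) = v∈S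
  Reach-target (step _ _ v∈S) = v∈S

  Reach-trans : ∀ {u v w} → Reach E S u v → Reach E S v w → Reach E S u w
  Reach-trans walk (here _) = walk
  Reach-trans walk (step walk′ e w∈S) = step (Reach-trans walk walk′) e w∈S

  Reach-sym : (∀ {a b} → E a b → E b a) → ∀ {u v} → Reach E S u v → Reach E S v u
  Reach-sym _ (here u∈S) = here u∈S
  Reach-sym E-sym (step walk e v∈S) =
    Reach-trans (step (here v∈S) (E-sym e) (Reach-target walk)) (Reach-sym E-sym walk)

  Reach-restrict : ∀ {S′ u v} → (∀ {x} → Reach E S u x → x ∈ S′) → Reach E S u v → Reach E S′ u v
  Reach-restrict inS′ (here u∈S) = here (inS′ (here u∈S))
  Reach-restrict inS′ (step walk e v∈S) = step (Reach-restrict inS′ walk) e (inS′ (step walk e v∈S))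

module _ (G : Graph) where
  private
    V = Fin (n G)
    E = Adj G

  IsVertexCut-swap : ∀ {L R} → IsVertexCut G L R → IsVertexCut G R L
  IsVertexCut-swap (cover , left , right , noEdge) =
    Sum.swap ∘ cover , right , left , λ u v u∈R─L v∈L─R e → noEdge v u v∈L─R u∈R─L (sym G e)

  IsVertexCut-∉ˡ⇒∈ʳ : ∀ {L R v} → IsVertexCut G L R → v ∉ L → v ∈ R
  IsVertexCut-∉ˡ⇒∈ʳ {v = v} (cover , _) v∉L = [ (λ v∈L → contradiction v∈L v∉L) , id ] (cover v)

  IsVertexCut-neighbour : ∀ {L R u v} → IsVertexCut G L R → u ∈ L ─ R → E u v → v ∈ L
  IsVertexCut-neighbour {L} {v = v} cut@(_ , _ , _ , noEdge) u∈L─R e with v ∈? L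
  ... | yes v∈L = v∈L
  ... | no v∉L = contradiction e (noEdge _ v u∈L─R (x∈p∧x∉q⇒x∈p─q (IsVertexCut-∉ˡ⇒∈ʳ cut v∉L) v∉L))

  IsVertexCut-∪ʳ : ∀ {L R} Z → IsVertexCut G L R → Nonempty (L ─ (R ∪ Z)) → IsVertexCut G L (R ∪ Z)
  IsVertexCut-∪ʳ {L} {R} Z cut@(cover , _ , (b , b∈R─L) , noEdge) left =
    Sum.map₂ (p⊆p∪q Z) ∘ cover , left , (b , enlargeRight b∈R─L) ,
    λ u v u∈ v∈ → noEdge u v (shrinkLeft u∈) (shrinkRight v∈)
    where
    enlargeRight : ∀ {v} → v ∈ R ─ L → v ∈ (R ∪ Z) ─ L
    enlargeRight v∈ with x∈p─q⁻ R L v∈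
    ... | v∈R , v∉L = x∈p∧x∉q⇒x∈p─q (p⊆p∪q Z v∈R) v∉L
    shrinkLeft : ∀ {u} → u ∈ L ─ (R ∪ Z) → u ∈ L ─ R
    shrinkLeft u∈ with x∈p─q⁻ L _ u∈
    ... | u∈L , u∉R∪Z = x∈p∧x∉q⇒x∈p─q u∈L (u∉R∪Z ∘ p⊆p∪q Z)
    shrinkRight : ∀ {v} → v ∈ (R ∪ Z) ─ L → v ∈ R ─ L
    shrinkRight v∈ with x∈p─q⁻ _ L v∈
    ... | _ , v∉L = x∈p∧x∉q⇒x∈p─q (IsVertexCut-∉ˡ⇒∈ʳ cut v∉L) v∉L

  module _ (T : Subset (n G)) where

    reachable-isComponent : ∀ {w} (reach? : Decidable (Reach E (∁ T) w)) → w ∈ ∁ T →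
      IsComponent G T (toSubset reach?)
    reachable-isComponent {w} reach? w∉T =
        (λ v v∈D → x∈∁p⇒x∉p (Reach-target (∈toSubset⁻ reach? v∈D)))
      , (w , ∈toSubset⁺ reach? (here w∉T))
      , (λ u v u∈D v∈D → Reach-trans (Reach-sym (sym G) (within u∈D)) (within v∈D))
      , (λ u v u∈D v∉T e → ∈toSubset⁺ reach? (step (∈toSubset⁻ reach? u∈D) e (x∉p⇒x∈∁p v∉T)))
      where
      within : ∀ {v} → v ∈ toSubset reach? → Reach E (toSubset reach?) w v
      within v∈D = Reach-restrict (∈toSubset⁺ reach?) (∈toSubset⁻ reach? v∈D)

    torsoAdj-viaComponent : ∀ {w t u v} (reach? : Decidable (Reach E (∁ T) w)) → w ∈ ∁ T →
      t ∈ T → v ∈ T → t ≢ v → E t w → Reach E (∁ T) w u → E u v → TorsoAdj G T t v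
    torsoAdj-viaComponent {w} {t} {u} {v} reach? w∉T t∈T v∈T t≢v etw walk euv =
      t∈T , v∈T , t≢v ,
      inj₂ (D , reachable-isComponent reach? w∉T ,
            (∉D t∈T , w , ∈toSubset⁺ reach? (here w∉T) , sym G etw) ,
            (∉D v∈T , u , ∈toSubset⁺ reach? walk , euv))
      where
      D = toSubset reach?
      ∉D : ∀ {x} → x ∈ T → x ∉ D
      ∉D x∈T x∈D = x∈∁p⇒x∉p (Reach-target (∈toSubset⁻ reach? x∈D)) x∈T

    -- Along a walk in A ∪ (V ∖ T), the last vertex t in T is torso-reachable from c; every
    -- later vertex lies in a single component of G ∖ T, which has t in its neighbourhood.
    walk⇒torsoWalk : (A : Subset (n G)) (reach? : ∀ w → Decidable (Reach E (∁ T) w)) →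
      ∀ {c v} → c ∈ A ∩ T → Reach E (A ∪ ∁ T) c v → v ∈ T → Reach (TorsoAdj G T) (A ∩ T) c v
    walk⇒torsoWalk A reach? {c} {v} c∈A∩T walk v∈T = trail⇒torsoWalk (trail walk)
      where
      TorsoWalk = Reach (TorsoAdj G T) (A ∩ T) c

      Trail : V → Set
      Trail v = (v ∈ T × TorsoWalk v)
              ⊎ (v ∉ T × ∃₂ λ t w → TorsoWalk t × E t w × Reach E (∁ T) w v)

      entry : ∀ {v} → v ∈ A ∪ ∁ T → v ∈ T → v ∈ A ∩ T
      entry v∈A∪∁T v∈T with x∈p∪q⁻ A (∁ T) v∈A∪∁T
      ... | inj₁ v∈A = x∈p∩q⁺ (v∈A , v∈T)
      ... | inj₂ v∈∁T = contradiction v∈T (x∈∁p⇒x∉p v∈∁T)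

      trail : ∀ {v} → Reach E (A ∪ ∁ T) c v → Trail v
      trail (here _) = inj₁ (proj₂ (x∈p∩q⁻ A T c∈A∩T) , here c∈A∩T)
      trail {v} (step walk e v∈B) with v ∈? T | trail walk
      ... | yes v∈T | inj₁ (u∈T , tw) =
        inj₁ (v∈T , step tw (u∈T , v∈T , (λ { refl → irrefl G e }) , inj₁ e) (entry v∈B v∈T))
      ... | yes v∈T | inj₂ (_ , t , w , tw , etw , rw) with t ≟ v
      ...   | yes refl = inj₁ (v∈T , tw)
      ...   | no t≢v = inj₁ (v∈T , step tw torsoEdge (entry v∈B v∈T))
        where
        t∈T = proj₂ (x∈p∩q⁻ A T (Reach-target tw))
        torsoEdge = torsoAdj-viaComponent (reach? w) (Reach-source rw) t∈T v∈T t≢v etw rw e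
      trail {v} (step {w = u} walk e v∈B) | no v∉T | inj₁ (_ , tw) =
        inj₂ (v∉T , u , v , tw , e , here (x∉p⇒x∈∁p v∉T))
      trail {v} (step walk e v∈B) | no v∉T | inj₂ (_ , t , w , tw , etw , rw) =
        inj₂ (v∉T , t , w , tw , etw , step rw e (x∉p⇒x∈∁p v∉T))

      trail⇒torsoWalk : Trail v → TorsoWalk v
      trail⇒torsoWalk (inj₁ (_ , torsoWalk)) = torsoWalk
      trail⇒torsoWalk (inj₂ (v∉T , _)) = contradiction v∈T v∉T

-- The left part of (L, R) restricted to P. The new separator keeps all of (L ∩ R) ∩ T, which
-- costs nothing, as heavy cuts only count separator vertices outside T.
module Restriction (G : Graph) (T L R P : Subset (n G)) where

  Closed : Set
  Closed = ∀ {u v} → u ∈ (L ─ R) ∩ P → v ∈ (L ─ R) ∪ ∁ T → Adj G u v → v ∈ P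

  L′ R′ : Subset (n G)
  L′ = L ∩ (P ∪ (R ∩ T))
  R′ = ∁ ((L ─ R) ∩ P)

  L′⊆L : L′ ⊆ L
  L′⊆L = p∩q⊆p L _

  ∈L′ : x ∈ L → x ∈ P ⊎ x ∈ R ∩ T → x ∈ L′
  ∈L′ x∈L x∈P⊎R∩T = x∈p∩q⁺ (x∈L , x∈p∪q⁺ x∈P⊎R∩T)

  ∉L─R⇒∈R′ : x ∉ L ─ R → x ∈ R′
  ∉L─R⇒∈R′ x∉L─R = x∉p⇒x∈∁p (x∉L─R ∘ p∩q⊆p (L ─ R) P)

  L′─R′⊆L─R∩P : L′ ─ R′ ⊆ (L ─ R) ∩ P
  L′─R′⊆L─R∩P x∈ = x∉∁p⇒x∈p (proj₂ (x∈p─q⁻ L′ R′ x∈))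

  L─R∩P⊆L′─R′ : (L ─ R) ∩ P ⊆ L′ ─ R′
  L─R∩P⊆L′─R′ x∈ with x∈p∩q⁻ (L ─ R) P x∈
  ... | x∈L─R , x∈P = x∈p∧x∉q⇒x∈p─q (∈L′ (proj₁ (x∈p─q⁻ L R x∈L─R)) (inj₁ x∈P)) (x∈p⇒x∉∁p x∈)

  L′∩R′⊆L∩R : L′ ∩ R′ ⊆ L ∩ R
  L′∩R′⊆L∩R {x} x∈ with x∈p∩q⁻ L′ R′ x∈
  ... | x∈L′ , x∈R′ with x∈p∩q⁻ L _ x∈L′
  ... | x∈L , x∈P∪R∩T = x∈p∩q⁺ (x∈L , x∈p∧x∉p─q⇒x∈q L R x∈L x∉L─R)
    where
    x∉L─R : x ∉ L ─ R
    x∉L─R x∈L─R with x∈p∪q⁻ P (R ∩ T) x∈P∪R∩T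
    ... | inj₁ x∈P = x∈∁p⇒x∉p x∈R′ (x∈p∩q⁺ (x∈L─R , x∈P))
    ... | inj₂ x∈R∩T = proj₂ (x∈p─q⁻ L R x∈L─R) (proj₁ (x∈p∩q⁻ R T x∈R∩T))

  L′∩R′─T⊆L∩R─T∩P : (L′ ∩ R′) ─ T ⊆ ((L ∩ R) ─ T) ∩ P
  L′∩R′─T⊆L∩R─T∩P x∈ with x∈p─q⁻ (L′ ∩ R′) T x∈
  ... | x∈L′∩R′ , x∉T with x∈p∪q⁻ P (R ∩ T) (proj₂ (x∈p∩q⁻ L _ (proj₁ (x∈p∩q⁻ L′ R′ x∈L′∩R′))))
  ...   | inj₁ x∈P = x∈p∩q⁺ (x∈p∧x∉q⇒x∈p─q (L′∩R′⊆L∩R x∈L′∩R′) x∉T , x∈P)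
  ...   | inj₂ x∈R∩T = contradiction (proj₂ (x∈p∩q⁻ R T x∈R∩T)) x∉T

  IsVertexCut-restrict : IsVertexCut G L R → Closed → Nonempty (L′ ─ R′) → IsVertexCut G L′ R′
  IsVertexCut-restrict cut@(_ , _ , (b , b∈R─L) , _) closed left = cover , left , right , noEdge
    where
    cover : ∀ x → x ∈ L′ ⊎ x ∈ R′
    cover x with x ∈? (L ─ R) ∩ P
    ... | yes x∈ = inj₁ (p─q⊆p L′ R′ (L─R∩P⊆L′─R′ x∈))
    ... | no x∉ = inj₂ (x∉p⇒x∈∁p x∉)
    right : ∃ λ x → x ∈ R′ ─ L′
    right = b , x∈p∧x∉q⇒x∈p─q (∉L─R⇒∈R′ (b∉L ∘ p─q⊆p L R)) (b∉L ∘ L′⊆L)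
      where b∉L = proj₂ (x∈p─q⁻ R L b∈R─L)
    noEdge : ∀ u v → u ∈ L′ ─ R′ → v ∈ R′ ─ L′ → ¬ Adj G u v
    noEdge u v u∈L′─R′ v∈R′─L′ e = proj₂ (x∈p─q⁻ R′ L′ v∈R′─L′) v∈L′
      where
      u∈L─R∩P = L′─R′⊆L─R∩P u∈L′─R′
      v∈L = IsVertexCut-neighbour G cut (p∩q⊆p (L ─ R) P u∈L─R∩P) e
      v∈L′ : v ∈ L′
      v∈L′ with v ∈? P
      ... | yes v∈P = ∈L′ v∈L (inj₁ v∈P)
      ... | no v∉P = ∈L′ v∈L (inj₂ (x∈p∩q⁺ (x∈p∧x∉p─q⇒x∈q L R v∈L v∉L─R , x∉∁p⇒x∈p v∉∁T)))
        where
        v∉L─R∪∁T : v ∉ (L ─ R) ∪ ∁ T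
        v∉L─R∪∁T v∈ = v∉P (closed u∈L─R∩P v∈ e)
        v∉L─R = v∉L─R∪∁T ∘ p⊆p∪q (∁ T)
        v∉∁T = v∉L─R∪∁T ∘ q⊆p∪q (L ─ R) (∁ T)

module _ (G : Graph) (X T Y : Subset (n G)) (Y⊆T : Y ⊆ T) (K : ℕ) where
  private
    E = Adj G

  -- An (X,T,K)-witness up to the connectivity of its torso part, carrying the count
  -- that makes it carve a vertex of Y and that survives splitting the left side.
  record Heavy (L R : Subset (n G)) : Set where
    field
      isVertexCut : IsVertexCut G L R
      small       : cutSize G L R ≤ K
      X⊆R         : X ⊆ R
      excess      : ∣ (L ∩ R) ─ T ∣ < ∣ (L ─ R) ∩ Y ∣

  Heavy⇒IsWitness : ∀ {L R} → Heavy L R → IsWitness G X T K L R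
  Heavy⇒IsWitness {L} {R} h = isVertexCut , small , separator<L∩T , X⊆R
    where
    open Heavy h
    open ≤-Reasoning
    S = L ∩ R
    S⊆S∩T∪S─T : S ⊆ (S ∩ T) ∪ (S ─ T)
    S⊆S∩T∪S─T {x} x∈S with x ∈? T
    ... | yes x∈T = x∈p∪q⁺ (inj₁ (x∈p∩q⁺ (x∈S , x∈T)))
    ... | no x∉T = x∈p∪q⁺ (inj₂ (x∈p∧x∉q⇒x∈p─q x∈S x∉T))
    separator<L∩T : ∣ S ∣ < ∣ L ∩ T ∣
    separator<L∩T = begin-strict
      ∣ S ∣                         ≤⟨ p⊆q∪r⇒∣p∣≤∣q∣+∣r∣ S⊆S∩T∪S─T ⟩
      ∣ S ∩ T ∣ + ∣ S ─ T ∣         <⟨ +-monoʳ-< ∣ S ∩ T ∣ excess ⟩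
      ∣ S ∩ T ∣ + ∣ (L ─ R) ∩ Y ∣   ≤⟨ disjoint⇒∣p∣+∣q∣≤∣r∣ S∩T⊆L∩T L─R∩Y⊆L∩T disjoint ⟩
      ∣ L ∩ T ∣                     ∎
      where
      S∩T⊆L∩T : S ∩ T ⊆ L ∩ T
      S∩T⊆L∩T x∈ with x∈p∩q⁻ S T x∈
      ... | x∈S , x∈T = x∈p∩q⁺ (p∩q⊆p L R x∈S , x∈T)
      L─R∩Y⊆L∩T : (L ─ R) ∩ Y ⊆ L ∩ T
      L─R∩Y⊆L∩T x∈ with x∈p∩q⁻ (L ─ R) Y x∈
      ... | x∈L─R , x∈Y = x∈p∩q⁺ (p─q⊆p L R x∈L─R , Y⊆T x∈Y)
      disjoint : ∀ {x} → x ∈ S ∩ T → x ∉ (L ─ R) ∩ Y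
      disjoint x∈S∩T x∈L─R∩Y =
        proj₂ (x∈p─q⁻ L R (p∩q⊆p _ Y x∈L─R∩Y)) (p∩q⊆q L R (p∩q⊆p S T x∈S∩T))

  Heavy⇒carvable : ∀ {L R} → Heavy L R → ConnectedOn (TorsoAdj G T) ((L ─ R) ∩ T) →
    ∃ λ y → y ∈ Y × Carvable G X T K y
  Heavy⇒carvable {L} {R} h connected with ∣p∣>0⇒Nonempty (≤-<-trans z≤n (Heavy.excess h))
  ... | y , y∈L─R∩Y with x∈p∩q⁻ (L ─ R) Y y∈L─R∩Y
  ... | y∈L─R , y∈Y = y , y∈Y , L , R , (Heavy⇒IsWitness h , connected) , y∈L─R

  small-separator⇒excess : ∀ {L R} → ∣ L ∩ R ∣ < ∣ L ∩ Y ∣ → ∣ (L ∩ R) ─ T ∣ < ∣ (L ─ R) ∩ Y ∣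
  small-separator⇒excess {L} {R} S<L∩Y = +-cancelʳ-< _ _ _ (begin-strict
    ∣ S ─ T ∣ + ∣ L ∩ Y ∣                       ≤⟨ +-monoʳ-≤ _ (p⊆q∪r⇒∣p∣≤∣q∣+∣r∣ L∩Y⊆S∩Y∪L─R∩Y) ⟩
    ∣ S ─ T ∣ + (∣ S ∩ Y ∣ + ∣ (L ─ R) ∩ Y ∣)   ≡⟨ +-assoc ∣ S ─ T ∣ _ _ ⟨
    ∣ S ─ T ∣ + ∣ S ∩ Y ∣ + ∣ (L ─ R) ∩ Y ∣     ≤⟨ +-monoˡ-≤ _ S─T+S∩Y≤S ⟩
    ∣ S ∣ + ∣ (L ─ R) ∩ Y ∣                     <⟨ +-monoˡ-< _ S<L∩Y ⟩
    ∣ L ∩ Y ∣ + ∣ (L ─ R) ∩ Y ∣                 ≡⟨ +-comm ∣ L ∩ Y ∣ _ ⟩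
    ∣ (L ─ R) ∩ Y ∣ + ∣ L ∩ Y ∣                 ∎)
    where
    open ≤-Reasoning
    S = L ∩ R
    L∩Y⊆S∩Y∪L─R∩Y : L ∩ Y ⊆ (S ∩ Y) ∪ ((L ─ R) ∩ Y)
    L∩Y⊆S∩Y∪L─R∩Y {x} x∈ with x∈p∩q⁻ L Y x∈ | x ∈? R
    ... | x∈L , x∈Y | yes x∈R = x∈p∪q⁺ (inj₁ (x∈p∩q⁺ (x∈p∩q⁺ (x∈L , x∈R) , x∈Y)))
    ... | x∈L , x∈Y | no x∉R = x∈p∪q⁺ (inj₂ (x∈p∩q⁺ (x∈p∧x∉q⇒x∈p─q x∈L x∉R , x∈Y)))
    S─T+S∩Y≤S : ∣ S ─ T ∣ + ∣ S ∩ Y ∣ ≤ ∣ S ∣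
    S─T+S∩Y≤S = disjoint⇒∣p∣+∣q∣≤∣r∣ (p─q⊆p S T) (p∩q⊆p S Y) λ x∈S─T x∈S∩Y →
      proj₂ (x∈p─q⁻ S T x∈S─T) (Y⊆T (p∩q⊆q S Y x∈S∩Y))

  Heavy-init : ∀ {L R} → IsVertexCut G L R → ∣ L ∩ X ∣ + cutSize G L R ≤ K → K < ∣ L ∩ Y ∣ →
    Heavy L (R ∪ X)
  Heavy-init {L} {R} cut size K<∣L∩Y∣ = record
    { isVertexCut = IsVertexCut-∪ʳ G X cut
                      (Product.map₂ (p∩q⊆p _ Y) (∣p∣>0⇒Nonempty (≤-<-trans z≤n excess)))
    ; small       = small
    ; X⊆R         = q⊆p∪q R X
    ; excess      = excess
    }
    where
    L∩R∪X⊆L∩X∪L∩R : L ∩ (R ∪ X) ⊆ (L ∩ X) ∪ (L ∩ R)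
    L∩R∪X⊆L∩X∪L∩R x∈ with x∈p∩q⁻ L (R ∪ X) x∈
    ... | x∈L , x∈R∪X with x∈p∪q⁻ R X x∈R∪X
    ...   | inj₁ x∈R = x∈p∪q⁺ (inj₂ (x∈p∩q⁺ (x∈L , x∈R)))
    ...   | inj₂ x∈X = x∈p∪q⁺ (inj₁ (x∈p∩q⁺ (x∈L , x∈X)))
    small : cutSize G L (R ∪ X) ≤ K
    small = ≤-trans (p⊆q∪r⇒∣p∣≤∣q∣+∣r∣ L∩R∪X⊆L∩X∪L∩R) size
    excess : ∣ (L ∩ (R ∪ X)) ─ T ∣ < ∣ (L ─ (R ∪ X)) ∩ Y ∣
    excess = small-separator⇒excess {L} {R ∪ X} (≤-<-trans small K<∣L∩Y∣)

  Heavy-restrict : ∀ {L R} (P : Subset (n G)) → Heavy L R → Restriction.Closed G T L R P →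
    ∣ ((L ∩ R) ─ T) ∩ P ∣ < ∣ ((L ─ R) ∩ Y) ∩ P ∣ →
    ∀ {a} → a ∈ L ─ R → a ∉ P →
    ∃₂ λ L′ R′ → Heavy L′ R′ × ∣ L′ ─ R′ ∣ < ∣ L ─ R ∣
  Heavy-restrict {L} {R} P h closed excess-P {a} a∈L─R a∉P = L′ , R′ , heavy′ , shrinks
    where
    open Heavy h
    open Restriction G T L R P
    open ≤-Reasoning

    excess′ : ∣ (L′ ∩ R′) ─ T ∣ < ∣ (L′ ─ R′) ∩ Y ∣
    excess′ = begin-strict
      ∣ (L′ ∩ R′) ─ T ∣        ≤⟨ p⊆q⇒∣p∣≤∣q∣ L′∩R′─T⊆L∩R─T∩P ⟩
      ∣ ((L ∩ R) ─ T) ∩ P ∣    <⟨ excess-P ⟩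
      ∣ ((L ─ R) ∩ Y) ∩ P ∣    ≤⟨ p⊆q⇒∣p∣≤∣q∣ L─R∩Y∩P⊆L′─R′∩Y ⟩
      ∣ (L′ ─ R′) ∩ Y ∣        ∎
      where
      L─R∩Y∩P⊆L′─R′∩Y : ((L ─ R) ∩ Y) ∩ P ⊆ (L′ ─ R′) ∩ Y
      L─R∩Y∩P⊆L′─R′∩Y x∈ with x∈p∩q⁻ _ P x∈
      ... | x∈L─R∩Y , x∈P with x∈p∩q⁻ (L ─ R) Y x∈L─R∩Y
      ... | x∈L─R , x∈Y = x∈p∩q⁺ (L─R∩P⊆L′─R′ (x∈p∩q⁺ (x∈L─R , x∈P)) , x∈Y)

    heavy′ : Heavy L′ R′
    heavy′ = record
      { isVertexCut = IsVertexCut-restrict isVertexCut closed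
                        (Product.map₂ (p∩q⊆p _ Y) (∣p∣>0⇒Nonempty (≤-<-trans z≤n excess′)))
      ; small       = ≤-trans (p⊆q⇒∣p∣≤∣q∣ L′∩R′⊆L∩R) small
      ; X⊆R         = λ x∈X → ∉L─R⇒∈R′ (λ x∈L─R → proj₂ (x∈p─q⁻ L R x∈L─R) (X⊆R x∈X))
      ; excess      = excess′
      }

    shrinks : ∣ L′ ─ R′ ∣ < ∣ L ─ R ∣
    shrinks = ≤-<-trans (p⊆q⇒∣p∣≤∣q∣ L′─R′⊆L─R∩P)
      (p⊂q⇒∣p∣<∣q∣ (p∩q⊆p (L ─ R) P , a , a∈L─R , a∉P ∘ p∩q⊆q (L ─ R) P))

  Heavy-split : ∀ {L R c d} → Heavy L R →
    (reachW? : Decidable (Reach E ((L ─ R) ∪ ∁ T) c)) →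
    (reach? : ∀ w → Decidable (Reach E (∁ T) w)) →
    c ∈ (L ─ R) ∩ T → d ∈ (L ─ R) ∩ T → ¬ Reach (TorsoAdj G T) ((L ─ R) ∩ T) c d →
    ∃₂ λ L′ R′ → Heavy L′ R′ × ∣ L′ ─ R′ ∣ < ∣ L ─ R ∣
  Heavy-split {L} {R} {c} {d} h reachW? reach? c∈L─R∩T d∈L─R∩T c≁d =
    [ (λ excess-W → Heavy-restrict W h W-closed excess-W d∈L─R d∉W)
    , (λ excess-∁W → Heavy-restrict (∁ W) h ∁W-closed excess-∁W c∈L─R (x∈p⇒x∉∁p c∈W))
    ] (m+n<o+p⇒m<o⊎n<p excess-split)
    where
    open Heavy h
    A = L ─ R
    W = toSubset reachW?
    c∈L─R = proj₁ (x∈p∩q⁻ A T c∈L─R∩T)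
    d∈L─R = proj₁ (x∈p∩q⁻ A T d∈L─R∩T)

    excess-split : ∣ ((L ∩ R) ─ T) ∩ W ∣ + ∣ ((L ∩ R) ─ T) ∩ ∁ W ∣
                 < ∣ (A ∩ Y) ∩ W ∣ + ∣ (A ∩ Y) ∩ ∁ W ∣
    excess-split =
      subst₂ _<_ (∣p∣≡∣p∩q∣+∣p∩∁q∣ ((L ∩ R) ─ T) W) (∣p∣≡∣p∩q∣+∣p∩∁q∣ (A ∩ Y) W) excess

    c∈W : c ∈ W
    c∈W = ∈toSubset⁺ reachW? (here (x∈p∪q⁺ (inj₁ c∈L─R)))

    d∉W : d ∉ W
    d∉W d∈W = c≁d (walk⇒torsoWalk G T A reach? c∈L─R∩T (∈toSubset⁻ reachW? d∈W)
                                   (proj₂ (x∈p∩q⁻ A T d∈L─R∩T)))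

    W-closed : Restriction.Closed G T L R W
    W-closed u∈A∩W v∈ e = ∈toSubset⁺ reachW? (step (∈toSubset⁻ reachW? (p∩q⊆q A W u∈A∩W)) e v∈)

    ∁W-closed : Restriction.Closed G T L R (∁ W)
    ∁W-closed u∈A∩∁W v∈ e = x∉p⇒x∈∁p λ v∈W →
      x∈∁p⇒x∉p (p∩q⊆q A (∁ W) u∈A∩∁W)
        (∈toSubset⁺ reachW? (step (∈toSubset⁻ reachW? v∈W) (sym G e) (p⊆p∪q (∁ T) u∈A)))
      where u∈A = p∩q⊆p A (∁ W) u∈A∩∁W

  -- Reachability is not decidable for an abstract adjacency relation, but the goal is ⊥,
  -- so the case distinctions on it can be made under double negation.
  ¬Heavy : (∀ y → y ∈ Y → ¬ Carvable G X T K y) → ∀ L R → ¬ Heavy L R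
  ¬Heavy noCarvable L R =
    All.wfRec (wellFounded leftSize <-wellFounded) _ (¬_ ∘ uncurry Heavy) descend (L , R)
    where
    leftSize : Subset (n G) × Subset (n G) → ℕ
    leftSize (L , R) = ∣ L ─ R ∣

    descend : ∀ LR → (∀ {LR′} → leftSize LR′ < leftSize LR → ¬ uncurry Heavy LR′) →
      ¬ uncurry Heavy LR
    descend (L , R) noSmaller h =
      ¬¬-decidable₂ (Reach (TorsoAdj G T) ((L ─ R) ∩ T)) λ torso? →
        let y , y∈Y , carvable = Heavy⇒carvable h (connected torso?) in noCarvable y y∈Y carvable
      where
      connected : (∀ u → Decidable (Reach (TorsoAdj G T) ((L ─ R) ∩ T) u)) →
        ConnectedOn (TorsoAdj G T) ((L ─ R) ∩ T)
      connected torso? u v u∈ v∈ with torso? u v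
      ... | yes walk = walk
      ... | no u≁v = ⊥-elim (
        ¬¬-decidable (Reach E ((L ─ R) ∪ ∁ T) u) λ reachW? →
        ¬¬-decidable₂ (Reach E (∁ T)) λ reach? →
        let _ , _ , h′ , shrinks = Heavy-split h reachW? reach? u∈ v∈ u≁v in noSmaller shrinks h′)

light-in-X⇒light-in-Y : (G : Graph) (X T Y : Subset (n G)) (q k : ℕ) → Y ⊆ T →
  (∀ y → y ∈ Y → ¬ Carvable G X T (q + k) y) →
  ∀ {L R} → IsVertexCut G L R → cutSize G L R ≤ k → ∣ L ∩ X ∣ ≤ q → ∣ L ∩ Y ∣ ≤ q + k
light-in-X⇒light-in-Y G X T Y q k Y⊆T noCarvable {L} {R} cut size ∣L∩X∣≤q
  with ∣ L ∩ Y ∣ ≤? q + k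
... | yes ∣L∩Y∣≤q+k = ∣L∩Y∣≤q+k
... | no ∣L∩Y∣≰q+k = ⊥-elim (¬Heavy G X T Y Y⊆T (q + k) noCarvable L (R ∪ X)
  (Heavy-init G X T Y Y⊆T (q + k) cut (+-mono-≤ ∣L∩X∣≤q size) (≰⇒> ∣L∩Y∣≰q+k)))

lemma5p5 : (G : Graph) (X T Y : Subset (n G)) (q k : ℕ) →
    X ⊆ T → k ≤ q → X ⊆ Y → Y ⊆ T →
    Unbreakable G q k X →
    (∀ y → y ∈ Y → ¬ Carvable G X T (q + k) y) →
    Unbreakable G (q + k) k Y
lemma5p5 G X T Y q k _ _ _ Y⊆T unbreakable noCarvable L R cut size =
  Sum.map (lightSide cut size) (lightSide (IsVertexCut-swap G cut) size′) (unbreakable L R cut size)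
  where
  lightSide = light-in-X⇒light-in-Y G X T Y q k Y⊆T noCarvable
  size′ : cutSize G R L ≤ k
  size′ = subst (λ S → ∣ S ∣ ≤ k) (∩-comm L R) size
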